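{- (a) Let $\mathcal{C}$ be a small category with set of arrows $M$, set of objects $O$, maps $\mathit{dom},\mathit{cod}:M\to O$, $\mathit{id}:O\to M$, and composition $x\circ y$ defined iff $\mathit{cod}\,x=\mathit{dom}\,y$ (diagrammatic order, so $\mathit{dom}(x\circ y)=\mathit{dom}\,x$, $\mathit{cod}(x\circ y)=\mathit{cod}\,y$, $\mathit{id}(\mathit{dom}\,x)\circ x=x=x\circ\mathit{id}(\mathit{cod}\,x)$). Define $\ell=\mathit{id}\circ\mathit{dom}$, $r=\mathit{id}\circ\mathit{cod}:M\to M$ and $R^x_{yz}\iff \mathit{cod}\,y=\mathit{dom}\,z\wedge x=y\circ z$. Then $(M,R,\ell,r)$ is an $\ell r$-category. (b) Conversely, let $(X,R,\ell,r)$ be an $\ell r$-category. Put $M=X$, $O=\{x\in X\mid \ell x=x\}$, $\mathit{id}:O\to M$ the inclusion, $\mathit{dom}=\ell$ and $\mathit{cod}=r$ (regarded as maps $M\to O$), and composition $x\circ y=$ the unique $z$ with $R^z_{xy}$, defined iff $r x=\ell y$. Then this is a small category (satisfying $\mathit{dom}(\mathit{id}\,A)=A=\mathit{cod}(\mathit{id}\,A)$, the domain/codomain laws for composites, associativity, and the identity laws).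
   Context: For a ternary relation $R\subseteq X\times X\times X$ write $R^x_{yz}$ for $(x,y,z)\in R$, and $D^y_z\iff\exists x.\ R^x_{yz}$. $R$ is a partial operation if for all $y,z$ there is at most one $x$ with $R^x_{yz}$; relationally associative if $(\exists v.\ R^u_{xv}\wedge R^v_{yz})\iff(\exists v.\ R^u_{vz}\wedge R^v_{xy})$ for all $u,x,y,z$. An $\ell r$-category is $(X,R,\ell,r)$ with $\ell,r:X\to X$ and $R$ a relationally associative partial operation such that for all $x,y,v$: $r(\ell x)=\ell x$, $\ell(r x)=r x$; $R^x_{(\ell x)x}$ and $R^x_{x(r x)}$; $R^v_{xy}\Rightarrow\ell v=\ell x$ and $R^v_{xy}\Rightarrow r v=r y$; $D^x_y\iff r x=\ell y$; $R^y_{(\ell x)x}\Rightarrow x=y$; $R^y_{x(r x)}\Rightarrow x=y$. -}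

module Defs where

open import Data.Product using (Σ; ∃; _×_; _,_; proj₁)
open import Function.Bundles using (_⇔_)
open import Relation.Binary.PropositionalEquality using (_≡_; trans; sym; cong)

-- D^y_z  iff  ∃ x. R^x_{yz}   (R x y z  means  R^x_{yz})
Def : {X : Set} → (X → X → X → Set) → X → X → Set
Def {X} R y z = ∃ λ x → R x y z

record IsLRCategory (X : Set) (R : X → X → X → Set) (ℓ r : X → X) : Set where
  field
    partial   : ∀ {x x′ y z} → R x y z → R x′ y z → x ≡ x′
    rel-assoc : ∀ u x y z →
                (∃ λ v → R u x v × R v y z) ⇔ (∃ λ v → R u v z × R v x y)
    rℓ        : ∀ x → r (ℓ x) ≡ ℓ x
    ℓr        : ∀ x → ℓ (r x) ≡ r x
    ℓ-unit    : ∀ x → R x (ℓ x) x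
    r-unit    : ∀ x → R x x (r x)
    ℓ-R       : ∀ {v x y} → R v x y → ℓ v ≡ ℓ x
    r-R       : ∀ {v x y} → R v x y → r v ≡ r y
    D-iff     : ∀ x y → Def R x y ⇔ (r x ≡ ℓ y)
    ℓ-uniq    : ∀ {x y} → R y (ℓ x) x → x ≡ y
    r-uniq    : ∀ {x y} → R y x (r x) → x ≡ y

record IsSmallCategory (M O : Set) (dom cod : M → O) (id : O → M)
                       (comp : (x y : M) → cod x ≡ dom y → M) : Set where
  field
    dom-id : ∀ A → dom (id A) ≡ A
    cod-id : ∀ A → cod (id A) ≡ A
    dom-∘  : ∀ x y (p : cod x ≡ dom y) → dom (comp x y p) ≡ dom x
    cod-∘  : ∀ x y (p : cod x ≡ dom y) → cod (comp x y p) ≡ cod y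
    assoc  : ∀ x y z (p : cod x ≡ dom y) (q : cod y ≡ dom z) →
             comp (comp x y p) z (trans (cod-∘ x y p) q)
               ≡ comp x (comp y z q) (trans p (sym (dom-∘ y z q)))
    id-l   : ∀ x → comp (id (dom x)) x (cod-id (dom x)) ≡ x
    id-r   : ∀ x → comp x (id (cod x)) (sym (dom-id (cod x))) ≡ x

CatRel : {M O : Set} (dom cod : M → O) →
         ((x y : M) → cod x ≡ dom y → M) → M → M → M → Set
CatRel dom cod comp x y z = Σ (cod y ≡ dom z) λ p → x ≡ comp y z p

FixObj : {X : Set} → (X → X) → Set
FixObj {X} ℓ = Σ X λ x → ℓ x ≡ x

module LR→Cat {X : Set} {R : X → X → X → Set} {ℓ r : X → X}
              (L : IsLRCategory X R ℓ r) where
  open IsLRCategory L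

  ℓℓ : ∀ x → ℓ (ℓ x) ≡ ℓ x
  ℓℓ x = trans (cong ℓ (sym (rℓ x))) (trans (ℓr (ℓ x)) (rℓ x))

  domO : X → FixObj ℓ
  domO x = ℓ x , ℓℓ x

  codO : X → FixObj ℓ
  codO x = r x , ℓr x

-- The composability witness cod x ≡ dom y is
-- irrelevant by UIP, so CatRel is a partial operation; conversely a composite in an
-- ℓr-category is the unique element related to its factors, so associativity of composition
-- follows from relational associativity together with partiality.
module Submission where

open import Defs
open import Axiom.UniquenessOfIdentityProofs.WithK using (uip)
open import Data.Product using (Σ; _×_; proj₁; proj₂; _,_)
open import Function.Base using (_∘_)
open import Function.Bundles using (mk⇔; Equivalence)
open import Relation.Binary.PropositionalEquality using (_≡_; refl; sym; trans; cong; subst)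

module SmallCategory⇒LRCategory
  {M O : Set} {dom cod : M → O} {id : O → M}
  {comp : (x y : M) → cod x ≡ dom y → M}
  (C : IsSmallCategory M O dom cod id comp) where

  open IsSmallCategory C

  R : M → M → M → Set
  R = CatRel dom cod comp

  comp-irrelevant : ∀ {x y} (p q : cod x ≡ dom y) → comp x y p ≡ comp x y q
  comp-irrelevant p q = cong (comp _ _) (uip p q)

  id-injective : ∀ {A B} → id A ≡ id B → A ≡ B
  id-injective {A} {B} e = trans (sym (dom-id A)) (trans (cong dom e) (dom-id B))

  R-assoc-⇒ : ∀ u x y z → Σ M (λ v → R u x v × R v y z) → Σ M (λ v → R u v z × R v x y)
  R-assoc-⇒ u x y z (_ , (p , refl) , (q , refl)) =
    comp x y p′ , (trans (cod-∘ x y p′) q , trans (comp-irrelevant _ _) (sym (assoc x y z p′ q))) , (p′ , refl)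
    where
    p′ : cod x ≡ dom y
    p′ = trans p (dom-∘ y z q)

  R-assoc-⇐ : ∀ u x y z → Σ M (λ v → R u v z × R v x y) → Σ M (λ v → R u x v × R v y z)
  R-assoc-⇐ u x y z (_ , (p , refl) , (q , refl)) =
    comp y z q′ , (trans q (sym (dom-∘ y z q′)) , trans (comp-irrelevant _ _) (assoc x y z q q′)) , (q′ , refl)
    where
    q′ : cod y ≡ dom z
    q′ = trans (sym (cod-∘ x y q)) p

  isLRCategory : IsLRCategory M R (id ∘ dom) (id ∘ cod)
  isLRCategory = record
    { partial   = λ { (p , refl) (q , refl) → comp-irrelevant p q }
    ; rel-assoc = λ u x y z → mk⇔ (R-assoc-⇒ u x y z) (R-assoc-⇐ u x y z)
    ; rℓ        = λ x → cong id (cod-id (dom x))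
    ; ℓr        = λ x → cong id (dom-id (cod x))
    ; ℓ-unit    = λ x → cod-id (dom x) , sym (id-l x)
    ; r-unit    = λ x → sym (dom-id (cod x)) , sym (id-r x)
    ; ℓ-R       = λ { {x = x} {y} (p , refl) → cong id (dom-∘ x y p) }
    ; r-R       = λ { {x = x} {y} (p , refl) → cong id (cod-∘ x y p) }
    ; D-iff     = λ x y → mk⇔ (λ { (_ , p , _) → cong id p })
                              (λ e → comp x y (id-injective e) , id-injective e , refl)
    ; ℓ-uniq    = λ { {x} (p , refl) → sym (trans (comp-irrelevant p _) (id-l x)) }
    ; r-uniq    = λ { {x} (p , refl) → sym (trans (comp-irrelevant p _) (id-r x)) }
    }

module LRCategory⇒SmallCategory
  {X : Set} {R : X → X → X → Set} {ℓ r : X → X}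
  (L : IsLRCategory X R ℓ r) where

  open IsLRCategory L
  open LR→Cat L

  FixObj-≡ : {a b : FixObj ℓ} → proj₁ a ≡ proj₁ b → a ≡ b
  FixObj-≡ {a , _} refl = cong (a ,_) (uip _ _)

  ℓ-fixed⇒r-fixed : ∀ {a} → ℓ a ≡ a → r a ≡ a
  ℓ-fixed⇒r-fixed {a} e = trans (cong r (sym e)) (trans (rℓ a) e)

  R-reassoc : ∀ {u v w x y z} → R u x v → R v y z → R w x y → R u w z
  R-reassoc {u} {v} {w} {x} {y} {z} u=xv v=yz w=xy with Equivalence.to (rel-assoc u x y z) (v , u=xv , v=yz)
  ... | w′ , u=w′z , w′=xy = subst (λ t → R u t z) (partial w′=xy w=xy) u=w′z

  compose : (x y : X) → codO x ≡ domO y → X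
  compose x y p = proj₁ (Equivalence.from (D-iff x y) (cong proj₁ p))

  compose-R : (x y : X) (p : codO x ≡ domO y) → R (compose x y p) x y
  compose-R x y p = proj₂ (Equivalence.from (D-iff x y) (cong proj₁ p))

  isSmallCategory : IsSmallCategory X (FixObj ℓ) domO codO proj₁ compose
  isSmallCategory = record
    { dom-id = λ { (_ , e) → FixObj-≡ e }
    ; cod-id = λ { (_ , e) → FixObj-≡ (ℓ-fixed⇒r-fixed e) }
    ; dom-∘  = λ x y p → FixObj-≡ (ℓ-R (compose-R x y p))
    ; cod-∘  = λ x y p → FixObj-≡ (r-R (compose-R x y p))
    ; assoc  = λ x y z p q →
        partial (compose-R (compose x y p) z _)
                (R-reassoc (compose-R x (compose y z q) _) (compose-R y z q) (compose-R x y p))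
    ; id-l   = λ x → sym (ℓ-uniq (compose-R (ℓ x) x _))
    ; id-r   = λ x → sym (r-uniq (compose-R x (r x) _))
    }

proposition4p4 :
    ((M O : Set) (dom cod : M → O) (id : O → M)
      (comp : (x y : M) → cod x ≡ dom y → M) →
      IsSmallCategory M O dom cod id comp →
      IsLRCategory M (CatRel dom cod comp) (id ∘ dom) (id ∘ cod))
    ×
    ((X : Set) (R : X → X → X → Set) (ℓ r : X → X) →
      (L : IsLRCategory X R ℓ r) →
      Σ ((x y : X) → LR→Cat.codO L x ≡ LR→Cat.domO L y → X) λ comp →
        ((x y : X) (p : LR→Cat.codO L x ≡ LR→Cat.domO L y) → R (comp x y p) x y)
        × IsSmallCategory X (FixObj ℓ) (LR→Cat.domO L) (LR→Cat.codO L) proj₁ comp)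
proposition4p4 =
    (λ _ _ _ _ _ _ C → SmallCategory⇒LRCategory.isLRCategory C)
  , (λ _ _ _ _ L → let open LRCategory⇒SmallCategory L in compose , compose-R , isSmallCategory)
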